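{- Let $T$ be a deterministic synchronous mutual search algorithm for two agents on $n$ sites with cost $c$, and list the row lengths $|E_0|,\ldots,|E_{n-1}|$ in nondecreasing order as $\ell_1\le \ell_2\le\cdots\le \ell_n$. Then for every integer $k$ with $0\le k\le n-1$, the $(k+1)$st shortest row has length $\ell_{k+1}\le c/2+k$.
   Context: A deterministic synchronous mutual search (MS) algorithm for two agents on sites $V=\{0,\ldots,n-1\}$ is an ordered tournament $T=(V,E,\prec)$: $E$ contains, for each unordered pair $\{i,j\}$ of distinct sites, exactly one of the arcs $(i,j)$, $(j,i)$ (arc $(i,j)$: an agent at $i$ queries $j$), and $\prec$ is a total order on $E$. Row $E_i$ is the set of arcs leaving $i$, of length $|E_i|$. The cost of an arc $e=(i,j)$ is $c(e)=|\{f\in E_i: f\prec e\}|+1+|\{f\in E_j: f\prec e\}|$, and the cost of $T$ is $\max_{e\in E}c(e)$. -}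

module Defs where

open import Data.Nat using (ℕ; _+_; _⊔_; _<ᵇ_)
open import Data.Nat.Properties using (≤-decTotalOrder)
open import Data.Bool using (Bool; true; false; not; _∧_)
open import Data.Fin using (Fin)
open import Data.List using (List; length; filterᵇ; allFin; map; concatMap; foldr; drop; head)
open import Data.Maybe using (Maybe)
open import Data.Product using (_×_)
open import Relation.Binary.PropositionalEquality using (_≡_; _≢_)
import Data.List.Sort as Sort

-- An ordered tournament on sites Fin n.
--  * arc i j ≡ true  means the arc (i,j) ∈ E (an agent at i queries j);
--    exactly one of (i,j),(j,i) is an arc for i ≢ j, and there are no loops.
--  * the total order ≺ on E is given by an injective ranking `time` on arcs:
--    f ≺ e  iff  time f < time e.
record OrderedTournament (n : ℕ) : Set where
  field
    arc       : Fin n → Fin n → Bool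
    arc-irrefl : ∀ i → arc i i ≡ false
    arc-tourn : ∀ i j → i ≢ j → arc j i ≡ not (arc i j)
    time      : Fin n → Fin n → ℕ
    time-inj  : ∀ i j i' j' → arc i j ≡ true → arc i' j' ≡ true →
                time i j ≡ time i' j' → (i ≡ i') × (j ≡ j')

module _ {n : ℕ} (T : OrderedTournament n) where
  open OrderedTournament T

  row : Fin n → List (Fin n)
  row i = filterᵇ (arc i) (allFin n)

  rowLength : Fin n → ℕ
  rowLength i = length (row i)

  earlier : Fin n → ℕ → ℕ
  earlier i t = length (filterᵇ (λ j' → time i j' <ᵇ t) (row i))

  arcCost : Fin n → Fin n → ℕ
  arcCost i j = earlier i (time i j) + 1 + earlier j (time i j)

  cost : ℕ
  cost = foldr _⊔_ 0 (concatMap (λ i → map (arcCost i) (row i)) (allFin n))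

  sortedRowLengths : List ℕ
  sortedRowLengths = Sort.sort ≤-decTotalOrder (map rowLength (allFin n))

_‼?_ : {A : Set} → List A → ℕ → Maybe A
xs ‼? k = head (drop k xs)

-- Call a row long if it has at least k + m arcs; by sortedness at most k rows are short.
-- Take a time t at which some long row i has fewer than m arcs before t, while every
-- long row has at least m arcs before t + 1 (it exists since no row has an arc before
-- time 0 and every row is complete after the last time). The arc of i at time t is its
-- m-th, and i still has at least k + 1 arcs from time t on, so one of them goes to a
-- long row j. As the only arc at time t leaves i, j already has m arcs before t, and
-- the arc (i, j) costs at least (m - 1) + 1 + m = 2m. With ℓ = k + m, 2ℓ ≤ c + 2k.

module Submission where

open import Defs
open import Data.Bool using (Bool; true; false; _∨_; T)
open import Data.Bool.Properties using (T-≡; T-∨)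
open import Data.Fin using (Fin)
open import Data.Fin.Properties using (any?)
open import Data.List using (List; []; _∷_; length; filterᵇ; allFin; map; foldr; concatMap)
open import Data.List.Membership.Propositional using (_∈_; find; lose)
open import Data.List.Membership.Propositional.Properties using (∈-allFin; ∈-map⁺; ∈-concatMap⁺; ∈-filter⁺; ∈-filter⁻)
open import Data.List.Properties using (filter-all; filter-none; length-tabulate)
open import Data.List.Relation.Binary.Permutation.Propositional using (_↭_)
open import Data.List.Relation.Binary.Permutation.Propositional.Properties using (↭-length; filter-↭)
open import Data.List.Relation.Unary.All as All using (_∷_)
open import Data.List.Relation.Unary.AllPairs using (AllPairs; []; _∷_)
open import Data.List.Relation.Unary.Any using (here; there)
import Data.List.Relation.Unary.Any as Any
open import Data.List.Relation.Unary.Sorted.TotalOrder.Properties using (Sorted⇒AllPairs)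
open import Data.List.Relation.Unary.Unique.Propositional using (Unique)
open import Data.List.Relation.Unary.Unique.Propositional.Properties using (allFin⁺; filter⁺)
import Data.List.Sort as Sort
open import Data.Maybe using (just)
open import Data.Nat
open import Data.Nat.Properties
open import Data.Product using (_×_; _,_; proj₁; proj₂; ∃-syntax)
open import Data.Sum using (inj₁; inj₂)
import Data.Sum as Sum
open import Function using (_∘_; Equivalence)
open import Relation.Binary.Bundles using (DecTotalOrder)
open import Relation.Binary.PropositionalEquality
open import Relation.Nullary using (¬_; yes; no; contradiction)
open import Relation.Nullary.Decidable using (T?; ¬?; _×-dec_; decidable-stable)
open import Relation.Unary using (Decidable)

open Equivalence using (to; from)

count : {A : Set} → (A → Bool) → List A → ℕ
count p xs = length (filterᵇ p xs)

module _ {A : Set} where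

  count-none : ∀ {p : A → Bool} xs → (∀ {x} → x ∈ xs → ¬ T (p x)) → count p xs ≡ 0
  count-none {p} xs h = cong length (filter-none (T? ∘ p) (All.tabulate h))

  count-all : ∀ {p : A → Bool} xs → (∀ {x} → x ∈ xs → T (p x)) → count p xs ≡ length xs
  count-all {p} xs h = cong length (filter-all (T? ∘ p) (All.tabulate h))

  count-mono : ∀ {p q : A → Bool} xs → (∀ {x} → x ∈ xs → T (p x) → T (q x)) →
               count p xs ≤ count q xs
  count-mono [] h = z≤n
  count-mono {p} {q} (x ∷ xs) h with p x | q x | h (here refl) | count-mono xs (h ∘ there)
  ... | true  | true  | _   | ih = s≤s ih
  ... | true  | false | p⇒q | _  = contradiction _ p⇒q
  ... | false | true  | _   | ih = m≤n⇒m≤1+n ih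
  ... | false | false | _   | ih = ih

  count-∨ : ∀ (p q : A → Bool) xs → count (λ x → p x ∨ q x) xs ≤ count p xs + count q xs
  count-∨ p q [] = z≤n
  count-∨ p q (x ∷ xs) with p x | q x | count-∨ p q xs
  ... | true  | true  | ih = s≤s (≤-trans ih (+-monoʳ-≤ (count p xs) (n≤1+n _)))
  ... | true  | false | ih = s≤s ih
  ... | false | true  | ih = ≤-trans (s≤s ih) (≤-reflexive (sym (+-suc _ _)))
  ... | false | false | ih = ih

  count-<⇒∃ : ∀ {p q : A → Bool} xs → count p xs < count q xs →
              ∃[ x ] x ∈ xs × T (q x) × ¬ T (p x)
  count-<⇒∃ {p} {q} xs p<q with Any.any? (λ x → T? (q x) ×-dec ¬? (T? (p x))) xs
  ... | yes witness = find witness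
  ... | no ¬witness = contradiction (count-mono xs q⇒p) (<⇒≱ p<q)
    where
    q⇒p : ∀ {x} → x ∈ xs → T (q x) → T (p x)
    q⇒p {x} x∈xs qx = decidable-stable (T? (p x)) (λ ¬px → ¬witness (lose x∈xs (qx , ¬px)))

  count-≤1 : ∀ {p : A → Bool} {xs} → Unique xs →
             (∀ {x y} → x ∈ xs → y ∈ xs → T (p x) → T (p y) → x ≡ y) → count p xs ≤ 1
  count-≤1 [] h = z≤n
  count-≤1 {p} {x ∷ xs} (x∉xs ∷ unique) h with p x in px
  ... | false = count-≤1 unique (λ x∈ y∈ → h (there x∈) (there y∈))
  ... | true  = ≤-reflexive (cong suc (count-none xs
                  (λ y∈ py → All.lookup x∉xs y∈ (h (here refl) (there y∈) (from T-≡ px) py))))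

  count-filterᵇ : ∀ (p q : A → Bool) xs → count q (filterᵇ p xs) ≤ count q xs
  count-filterᵇ p q [] = z≤n
  count-filterᵇ p q (x ∷ xs) with p x
  ... | true with q x
  ...   | true  = s≤s (count-filterᵇ p q xs)
  ...   | false = count-filterᵇ p q xs
  count-filterᵇ p q (x ∷ xs) | false with q x
  ...   | true  = m≤n⇒m≤1+n (count-filterᵇ p q xs)
  ...   | false = count-filterᵇ p q xs

  count-↭ : ∀ (p : A → Bool) {xs ys} → xs ↭ ys → count p xs ≡ count p ys
  count-↭ p xs↭ys = ↭-length (filter-↭ (T? ∘ p) xs↭ys)

count-map : ∀ {A B : Set} (p : B → Bool) (f : A → B) xs → count p (map f xs) ≡ count (p ∘ f) xs
count-map p f [] = refl
count-map p f (x ∷ xs) with p (f x)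
... | true  = cong suc (count-map p f xs)
... | false = count-map p f xs

count-<-sorted : ∀ {xs ℓ} k → AllPairs _≤_ xs → xs ‼? k ≡ just ℓ → count (_<ᵇ ℓ) xs ≤ k
count-<-sorted {[]} _ _ _ = z≤n
count-<-sorted {x ∷ xs} zero (x≤xs ∷ _) refl = ≤-reflexive (count-none (x ∷ xs)
  (λ y∈ y<x → ≤⇒≯ (All.lookup (≤-refl ∷ x≤xs) y∈) (<ᵇ⇒< _ _ y<x)))
count-<-sorted {x ∷ xs} {ℓ} (suc k) (_ ∷ sorted) kth with x <ᵇ ℓ | count-<-sorted k sorted kth
... | true  | ih = s≤s ih
... | false | ih = m≤n⇒m≤1+n ih

¬<ᵇ⇒≥ : ∀ {m n} → ¬ T (m <ᵇ n) → n ≤ m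
¬<ᵇ⇒≥ m≮n = ≮⇒≥ (m≮n ∘ <⇒<ᵇ)

∈⇒≤-foldr-⊔ : ∀ {y} xs → y ∈ xs → y ≤ foldr _⊔_ 0 xs
∈⇒≤-foldr-⊔ (x ∷ xs) (here refl) = m≤m⊔n x _
∈⇒≤-foldr-⊔ (x ∷ xs) (there y∈xs) = ≤-trans (∈⇒≤-foldr-⊔ xs y∈xs) (m≤n⊔m x _)

boundary : ∀ {p} {P : ℕ → Set p} → Decidable P → P 0 → ∀ N → ¬ P N → ∃[ t ] P t × ¬ P (suc t)
boundary P? P0 zero ¬P0 = contradiction P0 ¬P0
boundary P? P0 (suc N) ¬PN+1 with P? N
... | yes PN = N , PN , ¬PN+1
... | no ¬PN = boundary P? P0 N ¬PN

module _ {n : ℕ} (tour : OrderedTournament n) where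
  open OrderedTournament tour

  ∈-row⁻ : ∀ {i j} → j ∈ row tour i → T (arc i j)
  ∈-row⁻ {i} = proj₂ ∘ ∈-filter⁻ (T? ∘ arc i) {xs = allFin n}

  arc⇒≢ : ∀ {i j} → T (arc i j) → j ≢ i
  arc⇒≢ {i} a refl = subst T (arc-irrefl i) a

  arc-time-injective : ∀ {i j i′ j′} → T (arc i j) → T (arc i′ j′) →
                       time i j ≡ time i′ j′ → i ≡ i′ × j ≡ j′
  arc-time-injective a a′ = time-inj _ _ _ _ (to T-≡ a) (to T-≡ a′)

  arcCost≤cost : ∀ {i j} → T (arc i j) → arcCost tour i j ≤ cost tour
  arcCost≤cost {i} {j} a = ∈⇒≤-foldr-⊔ _
    (∈-concatMap⁺ (λ i → map (arcCost tour i) (row tour i))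
      (lose (∈-allFin i) (∈-map⁺ (arcCost tour i) (∈-filter⁺ (T? ∘ arc i) (∈-allFin j) a))))

  timeBound : ℕ
  timeBound = foldr _⊔_ 0 (concatMap (λ i → map (time i) (allFin n)) (allFin n))

  time≤timeBound : ∀ i j → time i j ≤ timeBound
  time≤timeBound i j = ∈⇒≤-foldr-⊔ _
    (∈-concatMap⁺ (λ i → map (time i) (allFin n))
      (lose (∈-allFin i) (∈-map⁺ (time i) (∈-allFin j))))

  earlier-zero : ∀ i → earlier tour i 0 ≡ 0
  earlier-zero i = count-none (row tour i) (λ _ ())

  earlier-final : ∀ i → earlier tour i (suc timeBound) ≡ rowLength tour i
  earlier-final i = count-all (row tour i) (λ {j} _ → <⇒<ᵇ (s≤s (time≤timeBound i j)))

  earlier-mono : ∀ i {t t′} → t ≤ t′ → earlier tour i t ≤ earlier tour i t′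
  earlier-mono i t≤t′ = count-mono (row tour i) (λ _ lt → <⇒<ᵇ (<-≤-trans (<ᵇ⇒< _ _ lt) t≤t′))

  earlier-suc : ∀ i t → earlier tour i (suc t) ≤ earlier tour i t + 1
  earlier-suc i t = begin
      earlier tour i (suc t)
    ≤⟨ count-mono (row tour i) split ⟩
      count (λ j → (time i j <ᵇ t) ∨ (time i j ≡ᵇ t)) (row tour i)
    ≤⟨ count-∨ _ _ (row tour i) ⟩
      earlier tour i t + count (λ j → time i j ≡ᵇ t) (row tour i)
    ≤⟨ +-monoʳ-≤ (earlier tour i t) (count-≤1 (filter⁺ (T? ∘ arc i) (allFin⁺ n)) oneArcAtTime) ⟩
      earlier tour i t + 1 ∎
    where
    open ≤-Reasoning
    split : ∀ {j} → j ∈ row tour i → T (time i j <ᵇ suc t) → T ((time i j <ᵇ t) ∨ (time i j ≡ᵇ t))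
    split {j} _ lt = from (T-∨ {time i j <ᵇ t})
      (Sum.map <⇒<ᵇ (≡⇒≡ᵇ _ _) (m<1+n⇒m<n∨m≡n (<ᵇ⇒< (time i j) (suc t) lt)))
    oneArcAtTime : ∀ {x y} → x ∈ row tour i → y ∈ row tour i →
                   T (time i x ≡ᵇ t) → T (time i y ≡ᵇ t) → x ≡ y
    oneArcAtTime x∈ y∈ tx ty = proj₂ (arc-time-injective (∈-row⁻ x∈) (∈-row⁻ y∈)
      (trans (≡ᵇ⇒≡ _ _ tx) (sym (≡ᵇ⇒≡ _ _ ty))))

  earlier-suc-idle : ∀ i t → (∀ {j} → j ∈ row tour i → time i j ≢ t) →
                     earlier tour i (suc t) ≤ earlier tour i t
  earlier-suc-idle i t idle = count-mono (row tour i)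
    (λ j∈ lt → <⇒<ᵇ (≤∧≢⇒< (m<1+n⇒m≤n (<ᵇ⇒< _ _ lt)) (idle j∈)))

  earlier-<⇒arc : ∀ i t → earlier tour i t < earlier tour i (suc t) →
                  ∃[ j ] T (arc i j) × time i j ≡ t
  earlier-<⇒arc i t lt with count-<⇒∃ (row tour i) lt
  ... | j , j∈ , before , ¬before =
    j , ∈-row⁻ j∈ , ≤-antisym (m<1+n⇒m≤n (<ᵇ⇒< _ _ before)) (¬<ᵇ⇒≥ ¬before)

  module _ (k m : ℕ) (fewShort : count (λ j → rowLength tour j <ᵇ k + m) (allFin n) ≤ k) where

    Long : Fin n → Set
    Long j = k + m ≤ rowLength tour j

    Lagging : ℕ → Set
    Lagging t = ∃[ i ] Long i × earlier tour i t < m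

    lagging? : Decidable Lagging
    lagging? t = any? (λ i → (k + m ≤? rowLength tour i) ×-dec (earlier tour i t <? m))

    late-long-arc : ∀ i t → Long i → earlier tour i t < m →
                    ∃[ j ] T (arc i j) × t ≤ time i j × Long j
    late-long-arc i t long lag with count-<⇒∃ {q = λ _ → true} (row tour i) few
      where
      few : count (λ j → (rowLength tour j <ᵇ k + m) ∨ (time i j <ᵇ t)) (row tour i)
            < count (λ _ → true) (row tour i)
      few = begin-strict
          count (λ j → (rowLength tour j <ᵇ k + m) ∨ (time i j <ᵇ t)) (row tour i)
        ≤⟨ count-∨ _ _ (row tour i) ⟩
          count (λ j → rowLength tour j <ᵇ k + m) (row tour i) + earlier tour i t
        <⟨ +-mono-≤-< (≤-trans (count-filterᵇ (arc i) _ (allFin n)) fewShort) lag ⟩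
          k + m
        ≤⟨ long ⟩
          rowLength tour i
        ≡⟨ count-all (row tour i) _ ⟨
          count (λ _ → true) (row tour i) ∎
        where open ≤-Reasoning
    ... | j , j∈ , _ , ¬short∨before =
      j , ∈-row⁻ j∈ , ¬<ᵇ⇒≥ (¬short∨before ∘ from T-∨ ∘ inj₂) , ¬<ᵇ⇒≥ (¬short∨before ∘ from T-∨ ∘ inj₁)

    ¬lagging⇒caughtUp : ∀ t → ¬ Lagging t → ∀ j → Long j → m ≤ earlier tour j t
    ¬lagging⇒caughtUp t ¬lag j long = ≮⇒≥ (λ lt → ¬lag (j , long , lt))

    ¬lagging-at-end : ¬ Lagging (suc timeBound)
    ¬lagging-at-end (j , long , lag) =
      <⇒≱ lag (≤-trans (m≤n+m m k) (≤-trans long (≤-reflexive (sym (earlier-final j)))))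

    long-row : k < n → ∃[ i ] Long i
    long-row k<n with count-<⇒∃ {q = λ _ → true} (allFin n) fewShort<n
      where
      fewShort<n : count (λ j → rowLength tour j <ᵇ k + m) (allFin n) < count (λ _ → true) (allFin n)
      fewShort<n = ≤-<-trans fewShort (<-≤-trans k<n (≤-reflexive
        (sym (trans (count-all (allFin n) _) (length-tabulate _)))))
    ... | i , _ , _ , ¬short = i , ¬<ᵇ⇒≥ ¬short

    lagging-edge⇒2m≤cost : ∀ t → Lagging t → ¬ Lagging (suc t) → 2 * m ≤ cost tour
    lagging-edge⇒2m≤cost t (i , long-i , lag) ¬lag′
      with earlier-<⇒arc i t (<-≤-trans lag (¬lagging⇒caughtUp (suc t) ¬lag′ i long-i))
         | late-long-arc i t long-i lag
    ... | j₀ , arc-ij₀ , time-ij₀ | j , arc-ij , t≤time , long-j = begin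
        2 * m
      ≡⟨ cong (m +_) (+-identityʳ m) ⟩
        m + m
      ≤⟨ +-mono-≤ (≤-trans (¬lagging⇒caughtUp (suc t) ¬lag′ i long-i) (earlier-suc i t)) j-caughtUp ⟩
        earlier tour i t + 1 + earlier tour j t
      ≤⟨ +-mono-≤ (+-monoˡ-≤ 1 (earlier-mono i t≤time)) (earlier-mono j t≤time) ⟩
        arcCost tour i j
      ≤⟨ arcCost≤cost arc-ij ⟩
        cost tour ∎
      where
      open ≤-Reasoning
      j-caughtUp : m ≤ earlier tour j t
      j-caughtUp = ≤-trans (¬lagging⇒caughtUp (suc t) ¬lag′ j long-j) (earlier-suc-idle j t
        (λ x∈ eq → arc⇒≢ arc-ij (proj₁ (arc-time-injective (∈-row⁻ x∈) arc-ij₀ (trans eq (sym time-ij₀))))))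

    2m≤cost : k < n → 2 * m ≤ cost tour
    2m≤cost k<n with 0 <? m | long-row k<n
    ... | no m≯0 | _ = ≤-trans (*-monoʳ-≤ 2 (≮⇒≥ m≯0)) z≤n
    ... | yes m>0 | i , long-i
      with boundary lagging? (i , long-i , subst (_< m) (sym (earlier-zero i)) m>0)
                    (suc timeBound) ¬lagging-at-end
    ... | t , lag , ¬lag = lagging-edge⇒2m≤cost t lag ¬lag

  shortRows≤ : ∀ k {ℓ} → sortedRowLengths tour ‼? k ≡ just ℓ →
               count (λ j → rowLength tour j <ᵇ ℓ) (allFin n) ≤ k
  shortRows≤ k {ℓ} kth = begin
      count (λ j → rowLength tour j <ᵇ ℓ) (allFin n)
    ≡⟨ count-map (_<ᵇ ℓ) (rowLength tour) (allFin n) ⟨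
      count (_<ᵇ ℓ) (map (rowLength tour) (allFin n))
    ≡⟨ count-↭ (_<ᵇ ℓ) (Sort.sort-↭ ≤-decTotalOrder _) ⟨
      count (_<ᵇ ℓ) (sortedRowLengths tour)
    ≤⟨ count-<-sorted k (Sorted⇒AllPairs totalOrder (Sort.sort-↗ ≤-decTotalOrder _)) kth ⟩
      k ∎
    where
    open ≤-Reasoning
    open DecTotalOrder ≤-decTotalOrder using (totalOrder)

lemma6 : (n : ℕ) (T : OrderedTournament n) (k : ℕ) → k < n →
         ∀ ℓ → sortedRowLengths T ‼? k ≡ just ℓ →
         2 * ℓ ≤ cost T + 2 * k
lemma6 n tour k k<n ℓ kth with ≤-total ℓ k
... | inj₁ ℓ≤k = ≤-trans (*-monoʳ-≤ 2 ℓ≤k) (m≤n+m (2 * k) (cost tour))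
... | inj₂ k≤ℓ with m≤n⇒∃[o]m+o≡n k≤ℓ
... | m , refl = begin
    2 * (k + m)
  ≡⟨ *-distribˡ-+ 2 k m ⟩
    2 * k + 2 * m
  ≤⟨ +-monoʳ-≤ (2 * k) (2m≤cost tour k m (shortRows≤ tour k kth) k<n) ⟩
    2 * k + cost tour
  ≡⟨ +-comm (2 * k) (cost tour) ⟩
    cost tour + 2 * k ∎
  where open ≤-Reasoning
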